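{- Let $D_0$ be a diagram and let $D_1,D_2\in KD(D_0)$ with $D_2\prec D_1$. (a) If $c,r$ are positive integers with $D_1\cap\{(\tilde r,c):\tilde r\ge r\}=D_2\cap\{(\tilde r,c):\tilde r\ge r\}$, then every $D\in KD(D_0)$ with $D_2\preceq D\preceq D_1$ satisfies $D\cap\{(\tilde r,c):\tilde r\ge r\}=D_1\cap\{(\tilde r,c):\tilde r\ge r\}$. (b) If $c,r$ are positive integers with $D_1\cap\{(\tilde r,c):\tilde r\le r\}=D_2\cap\{(\tilde r,c):\tilde r\le r\}$, then every $D\in KD(D_0)$ with $D_2\preceq D\preceq D_1$ satisfies $D\cap\{(\tilde r,c):\tilde r\le r\}=D_1\cap\{(\tilde r,c):\tilde r\le r\}$.
   Context: A diagram is a finite set $D$ of cells $(r,c)$ with $r,c$ positive integers; $r$ is the row (rows numbered from bottom to top starting at 1) and $c$ the column (numbered from left to right starting at 1). A Kohnert move at row $r$ applied to a diagram $D$: if row $r$ of $D$ is empty, $D$ is unchanged; otherwise let $(r,c)$ be the cell of row $r$ with the largest column index; if every position $(r',c)$ with $1\le r'<r$ belongs to $D$, then $D$ is unchanged; otherwise let $r'$ be the largest integer with $1\le r'<r$ and $(r',c)\notin D$, and the move replaces the cell $(r,c)$ by $(r',c)$. For a diagram $D_0$, $KD(D_0)$ is the set of all diagrams obtainable from $D_0$ by finite (possibly empty) sequences of Kohnert moves; it is partially ordered by $D_2\preceq D_1$ iff $D_2$ can be obtained from $D_1$ by a finite sequence of Kohnert moves. -}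

module Defs where

open import Data.Nat using (ℕ; _<_; _≤_)
open import Data.Product using (_×_; _,_; Σ; ∃-syntax)
open import Data.Sum using (_⊎_)
open import Data.List using (List)
open import Data.List.Membership.Propositional using (_∈_; _∉_)
open import Relation.Binary.PropositionalEquality using (_≡_)
open import Relation.Nullary using (¬_)
open import Function.Bundles using (_⇔_)

-- A cell (r , c): r = row (bottom to top, from 1), c = column (from 1).
Cell : Set
Cell = ℕ × ℕ

-- A diagram is a finite set of cells, represented by a list (order and
-- repetitions irrelevant: diagrams are compared as sets via _≐_).
Diagram : Set
Diagram = List Cell

Positive : Diagram → Set
Positive D = ∀ r c → (r , c) ∈ D → (1 ≤ r × 1 ≤ c)

_≐_ : Diagram → Diagram → Set
D ≐ E = ∀ x → (x ∈ D ⇔ x ∈ E)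

-- A non-trivial Kohnert move at row r sending D to E: (r , c) is the
-- rightmost cell of row r, r' is the largest row below r with (r' , c) ∉ D,
-- and E = (D ∖ {(r , c)}) ∪ {(r' , c)}.  (Trivial moves leave D unchanged
-- and are covered by reflexivity of the reachability relation.)
record KohnertMove (D E : Diagram) : Set where
  field
    r c r' : ℕ
    cell∈     : (r , c) ∈ D
    rightmost : ∀ c' → c < c' → (r , c') ∉ D
    r'≥1      : 1 ≤ r'
    r'<r      : r' < r
    hole      : (r' , c) ∉ D
    full      : ∀ r'' → r' < r'' → r'' < r → (r'' , c) ∈ D
    result    : ∀ x → (x ∈ E ⇔ ((x ∈ D × ¬ (x ≡ (r , c))) ⊎ x ≡ (r' , c)))

data Reach : Diagram → Diagram → Set where
  done : ∀ {D E} → D ≐ E → Reach D E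
  step : ∀ {D D' E} → KohnertMove D D' → Reach D' E → Reach D E

_⪯_ : Diagram → Diagram → Set
D₂ ⪯ D₁ = Reach D₁ D₂

_≺_ : Diagram → Diagram → Set
D₂ ≺ D₁ = D₂ ⪯ D₁ × ¬ (D₂ ≐ D₁)

_∈KD_ : Diagram → Diagram → Set
D ∈KD D₀ = D ⪯ D₀

SameAbove : ℕ → ℕ → Diagram → Diagram → Set
SameAbove c r D E = ∀ r̃ → r ≤ r̃ → ((r̃ , c) ∈ D ⇔ (r̃ , c) ∈ E)

SameBelow : ℕ → ℕ → Diagram → Diagram → Set
SameBelow c r D E = ∀ r̃ → r̃ ≤ r → ((r̃ , c) ∈ D ⇔ (r̃ , c) ∈ E)

{-# OPTIONS --safe #-}
-- Fix a column c and count the cells of column c lying in rows < n.  A Kohnert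
-- move only ever moves a cell downwards within its column, so each such count
-- can only grow along a sequence of moves, while the total count of the column
-- is preserved.  If D₂ ⪯ D ⪯ D₁, the counts of D are therefore squeezed between
-- those of D₁ and D₂.  When D₁ and D₂ agree on column c above row r (resp. up to
-- row r), their counts agree at every threshold n ≥ r (resp. n ≤ r + 1), so the
-- counts of D agree with them there as well; consecutive counts then determine
-- each cell of column c in that range.
module Submission where

open import Defs
open import Data.Nat using (ℕ; zero; suc; _+_; _⊔_; _≤_; _<_; s≤s; _≟_; _≤?_)
open import Data.Nat.Properties
open import Data.Product using (_×_; _,_; proj₁; proj₂)
open import Data.Product.Properties using (≡-dec)
open import Data.Sum using (inj₁; inj₂; [_,_]′)
open import Data.List using ([]; _∷_)
open import Data.List.Membership.Propositional using (_∈_; _∉_)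
open import Data.List.Relation.Unary.Any using (here; there)
import Data.List.Membership.DecPropositional as DecMembership
open import Relation.Binary.PropositionalEquality
open import Relation.Nullary using (¬_; Dec; yes; no; contradiction)
open import Function.Bundles using (_⇔_; Equivalence; mk⇔)

open DecMembership (≡-dec _≟_ _≟_) using (_∈?_)

private
  variable
    P Q : Set
    X Y D D₁ D₂ : Diagram
    φ ψ : ℕ → ℕ
    n : ℕ

𝟙 : Dec P → ℕ
𝟙 (yes _) = 1
𝟙 (no _)  = 0

𝟙-yes : P → (p : Dec P) → 𝟙 p ≡ 1
𝟙-yes _ (yes _) = refl
𝟙-yes x (no ¬x) = contradiction x ¬x

𝟙-no : ¬ P → (p : Dec P) → 𝟙 p ≡ 0
𝟙-no ¬x (yes x) = contradiction x ¬x
𝟙-no _  (no _)  = refl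

𝟙-cong : P ⇔ Q → (p : Dec P) (q : Dec Q) → 𝟙 p ≡ 𝟙 q
𝟙-cong P⇔Q (yes x) q = sym (𝟙-yes (Equivalence.to P⇔Q x) q)
𝟙-cong P⇔Q (no ¬x) q = sym (𝟙-no (λ y → ¬x (Equivalence.from P⇔Q y)) q)

𝟙-injective : (p : Dec P) (q : Dec Q) → 𝟙 p ≡ 𝟙 q → P ⇔ Q
𝟙-injective (yes x) (yes y) _  = mk⇔ (λ _ → y) (λ _ → x)
𝟙-injective (no ¬x) (no ¬y) _  = mk⇔ (λ x → contradiction x ¬x) (λ y → contradiction y ¬y)
𝟙-injective (yes _) (no _)  ()
𝟙-injective (no _)  (yes _) ()

prefixSum : (ℕ → ℕ) → ℕ → ℕ
prefixSum f zero    = 0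
prefixSum f (suc n) = prefixSum f n + f n

prefixSum-cong : ∀ f g n → (∀ j → j < n → f j ≡ g j) → prefixSum f n ≡ prefixSum g n
prefixSum-cong f g zero    eq = refl
prefixSum-cong f g (suc n) eq =
  cong₂ _+_ (prefixSum-cong f g n (λ j j<n → eq j (m<n⇒m<1+n j<n))) (eq n ≤-refl)

prefixSum-step-cancel : ∀ f g n → prefixSum f n ≡ prefixSum g n →
  prefixSum f (suc n) ≡ prefixSum g (suc n) → f n ≡ g n
prefixSum-step-cancel f g n eq eq′ =
  +-cancelˡ-≡ (prefixSum f n) _ _ (trans eq′ (cong (_+ _) (sym eq)))

prefixSum-≡-downward : ∀ f g r B → (∀ j → r ≤ j → f j ≡ g j) →
  (∀ n → B ≤ n → prefixSum f n ≡ prefixSum g n) →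
  ∀ n → r ≤ n → prefixSum f n ≡ prefixSum g n
prefixSum-≡-downward f g r B agree top n r≤n = go B n (m≤m+n B n) r≤n
  where
  go : ∀ k n → B ≤ k + n → r ≤ n → prefixSum f n ≡ prefixSum g n
  go zero    n B≤n _   = top n B≤n
  go (suc k) n B≤k+n r≤n =
    +-cancelʳ-≡ (f n) _ _ (begin
      prefixSum f n + f n   ≡⟨ go k (suc n) (subst (B ≤_) (sym (+-suc k n)) B≤k+n) (m≤n⇒m≤1+n r≤n) ⟩
      prefixSum g n + g n   ≡⟨ cong (prefixSum g n +_) (sym (agree n r≤n)) ⟩
      prefixSum g n + f n   ∎)
    where open ≡-Reasoning

module PrefixSumTransfer {a b : ℕ} (b<a : b < a)
  (φa : φ a ≡ 1) (ψa : ψ a ≡ 0) (φb : φ b ≡ 0) (ψb : ψ b ≡ 1)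
  (agree : ∀ j → j ≢ a → j ≢ b → φ j ≡ ψ j) where

  open ≡-Reasoning

  private
    agree-below : ∀ j → j < b → φ j ≡ ψ j
    agree-below j j<b = agree j (λ j≡a → <-asym j<b (subst (b <_) (sym j≡a) b<a))
                                (λ j≡b → <-irrefl j≡b j<b)

    agree-between : ∀ j → b < j → j < a → φ j ≡ ψ j
    agree-between j b<j j<a = agree j (λ j≡a → <-irrefl j≡a j<a)
                                      (λ j≡b → <-irrefl (sym j≡b) b<j)

    agree-above : ∀ j → a < j → φ j ≡ ψ j
    agree-above j a<j = agree j (λ j≡a → <-irrefl (sym j≡a) a<j)
                                (λ j≡b → <-irrefl (sym j≡b) (<-trans b<a a<j))

  below : n ≤ b → prefixSum φ n ≡ prefixSum ψ n
  below {n} n≤b = prefixSum-cong φ ψ n (λ j j<n → agree-below j (<-≤-trans j<n n≤b))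

  between : b < n → n ≤ a → prefixSum ψ n ≡ suc (prefixSum φ n)
  between {suc n} b<1+n 1+n≤a with n ≟ b
  ... | yes refl = begin
    prefixSum ψ b + ψ b   ≡⟨ cong₂ _+_ (sym (below ≤-refl)) ψb ⟩
    prefixSum φ b + 1     ≡⟨ +-comm _ 1 ⟩
    suc (prefixSum φ b)   ≡⟨ cong suc (sym (+-identityʳ _)) ⟩
    suc (prefixSum φ b + 0) ≡⟨ cong (λ x → suc (prefixSum φ b + x)) (sym φb) ⟩
    suc (prefixSum φ b + φ b) ∎
  ... | no n≢b = cong₂ _+_ (between b<n (<⇒≤ 1+n≤a)) (sym (agree-between n b<n 1+n≤a))
    where b<n = ≤∧≢⇒< (≤-pred b<1+n) (≢-sym n≢b)

  above : a < n → prefixSum ψ n ≡ prefixSum φ n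
  above {suc n} a<1+n with n ≟ a
  ... | yes refl = begin
    prefixSum ψ a + ψ a   ≡⟨ cong₂ _+_ (between b<a ≤-refl) ψa ⟩
    suc (prefixSum φ a) + 0 ≡⟨ +-identityʳ _ ⟩
    suc (prefixSum φ a)   ≡⟨ +-comm 1 _ ⟩
    prefixSum φ a + 1     ≡⟨ cong (prefixSum φ a +_) (sym φa) ⟩
    prefixSum φ a + φ a   ∎
  ... | no n≢a = cong₂ _+_ (above a<n) (sym (agree-above n a<n))
    where a<n = ≤∧≢⇒< (≤-pred a<1+n) (≢-sym n≢a)

  mono : ∀ n → prefixSum φ n ≤ prefixSum ψ n
  mono n with n ≤? b | n ≤? a
  ... | yes n≤b | _        = ≤-reflexive (below n≤b)
  ... | no n≰b  | yes n≤a  = ≤-trans (n≤1+n _) (≤-reflexive (sym (between (≰⇒> n≰b) n≤a)))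
  ... | no _    | no n≰a   = ≤-reflexive (sym (above (≰⇒> n≰a)))

inColumn : ℕ → Diagram → ℕ → ℕ
inColumn c X j = 𝟙 ((j , c) ∈? X)

cellsBelow : ℕ → Diagram → ℕ → ℕ
cellsBelow c X = prefixSum (inColumn c X)

cellsBelow-≐ : ∀ c n → X ≐ Y → cellsBelow c X n ≡ cellsBelow c Y n
cellsBelow-≐ {X} {Y} c n X≐Y =
  prefixSum-cong (inColumn c X) (inColumn c Y) n (λ j _ → 𝟙-cong (X≐Y _) _ _)

cellsBelow-determines-cell : ∀ c j →
  cellsBelow c X j ≡ cellsBelow c Y j → cellsBelow c X (suc j) ≡ cellsBelow c Y (suc j) →
  (j , c) ∈ X ⇔ (j , c) ∈ Y
cellsBelow-determines-cell {X} {Y} c j eq eq′ =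
  𝟙-injective _ _ (prefixSum-step-cancel (inColumn c X) (inColumn c Y) j eq eq′)

RowBound : ℕ → Diagram → Set
RowBound B X = ∀ x → x ∈ X → proj₁ x < B

rowBound : Diagram → ℕ
rowBound []            = 0
rowBound ((r , _) ∷ X) = suc r ⊔ rowBound X

rowBound-correct : ∀ X → RowBound (rowBound X) X
rowBound-correct ((r , _) ∷ X) _ (here refl) = m≤m⊔n (suc r) (rowBound X)
rowBound-correct ((r , _) ∷ X) x (there x∈X) =
  ≤-trans (rowBound-correct X x x∈X) (m≤n⊔m (suc r) (rowBound X))

RowBound-weaken : ∀ {B} → B ≤ n → RowBound B X → RowBound n X
RowBound-weaken B≤n bound x x∈X = <-≤-trans (bound x x∈X) B≤n

module _ (mv : KohnertMove X Y) where
  open KohnertMove mv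
  private module Result x = Equivalence (result x)

  kohnert-untouched : ∀ x → x ≢ (r , c) → x ≢ (r' , c) → x ∈ X ⇔ x ∈ Y
  kohnert-untouched x x≢source x≢target = mk⇔
    (λ x∈X → Result.from x (inj₁ (x∈X , x≢source)))
    (λ x∈Y → [ proj₁ , (λ x≡target → contradiction x≡target x≢target) ]′ (Result.to x x∈Y))

  kohnert-source∉ : (r , c) ∉ Y
  kohnert-source∉ source∈Y with Result.to _ source∈Y
  ... | inj₁ (_ , source≢source) = source≢source refl
  ... | inj₂ source≡target       = <-irrefl (sym (cong proj₁ source≡target)) r'<r

  kohnert-target∈ : (r' , c) ∈ Y
  kohnert-target∈ = Result.from _ (inj₂ refl)

  RowBound-move : ∀ {B} → RowBound B X → RowBound B Y
  RowBound-move bound x x∈Y with Result.to x x∈Y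
  ... | inj₁ (x∈X , _) = bound x x∈X
  ... | inj₂ refl      = <-trans r'<r (bound _ cell∈)

  cellsBelow-move : ∀ c₀ n →
    cellsBelow c₀ X n ≤ cellsBelow c₀ Y n × (RowBound n X → cellsBelow c₀ Y n ≡ cellsBelow c₀ X n)
  cellsBelow-move c₀ n with c₀ ≟ c
  ... | yes refl =
    mono n , λ bound → above (bound _ cell∈)
    where
    open PrefixSumTransfer {φ = inColumn c X} {ψ = inColumn c Y} r'<r
      (𝟙-yes cell∈ _) (𝟙-no kohnert-source∉ _) (𝟙-no hole _) (𝟙-yes kohnert-target∈ _)
      (λ j j≢r j≢r' → 𝟙-cong (kohnert-untouched _ (λ e → j≢r (cong proj₁ e))
                                                  (λ e → j≢r' (cong proj₁ e))) _ _)
  ... | no c₀≢c =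
    ≤-reflexive same , λ _ → sym same
    where
    same : cellsBelow c₀ X n ≡ cellsBelow c₀ Y n
    same = prefixSum-cong (inColumn c₀ X) (inColumn c₀ Y) n (λ j _ →
      𝟙-cong (kohnert-untouched _ (λ e → c₀≢c (cong proj₂ e)) (λ e → c₀≢c (cong proj₂ e))) _ _)

RowBound-reach : ∀ {B} → Reach X Y → RowBound B X → RowBound B Y
RowBound-reach (done X≐Y)  bound x x∈Y = bound x (Equivalence.from (X≐Y x) x∈Y)
RowBound-reach (step mv reach) bound = RowBound-reach reach (RowBound-move mv bound)

cellsBelow-reach-≤ : ∀ c n → Reach X Y → cellsBelow c X n ≤ cellsBelow c Y n
cellsBelow-reach-≤ c n (done X≐Y)      = ≤-reflexive (cellsBelow-≐ c n X≐Y)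
cellsBelow-reach-≤ c n (step mv reach) =
  ≤-trans (proj₁ (cellsBelow-move mv c n)) (cellsBelow-reach-≤ c n reach)

cellsBelow-reach-≡ : ∀ c n → Reach X Y → RowBound n X → cellsBelow c Y n ≡ cellsBelow c X n
cellsBelow-reach-≡ c n (done X≐Y)      _     = sym (cellsBelow-≐ c n X≐Y)
cellsBelow-reach-≡ c n (step mv reach) bound =
  trans (cellsBelow-reach-≡ c n reach (RowBound-move mv bound)) (proj₂ (cellsBelow-move mv c n) bound)

cellsBelow-squeeze : ∀ c n → D₂ ⪯ D → D ⪯ D₁ →
  cellsBelow c D₁ n ≡ cellsBelow c D₂ n → cellsBelow c D n ≡ cellsBelow c D₁ n
cellsBelow-squeeze c n D₂⪯D D⪯D₁ eq =
  ≤-antisym (≤-trans (cellsBelow-reach-≤ c n D₂⪯D) (≤-reflexive (sym eq))) (cellsBelow-reach-≤ c n D⪯D₁)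

sameAbove-between : ∀ c r → SameAbove c r D₁ D₂ → D₂ ⪯ D → D ⪯ D₁ → SameAbove c r D D₁
sameAbove-between {D₁} {D₂} {D} c r same D₂⪯D D⪯D₁ j r≤j =
  cellsBelow-determines-cell c j (counts j r≤j) (counts (suc j) (m≤n⇒m≤1+n r≤j))
  where
  totals : ∀ n → rowBound D₁ ≤ n → cellsBelow c D₁ n ≡ cellsBelow c D₂ n
  totals n B≤n = sym (trans (cellsBelow-reach-≡ c n D₂⪯D (RowBound-reach D⪯D₁ bound))
                            (cellsBelow-reach-≡ c n D⪯D₁ bound))
    where bound = RowBound-weaken B≤n (rowBound-correct D₁)

  counts : ∀ n → r ≤ n → cellsBelow c D n ≡ cellsBelow c D₁ n
  counts n r≤n = cellsBelow-squeeze c n D₂⪯D D⪯D₁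
    (prefixSum-≡-downward (inColumn c D₁) (inColumn c D₂) r (rowBound D₁)
      (λ j r≤j → 𝟙-cong (same j r≤j) _ _) totals n r≤n)

sameBelow-between : ∀ c r → SameBelow c r D₁ D₂ → D₂ ⪯ D → D ⪯ D₁ → SameBelow c r D D₁
sameBelow-between {D₁} {D₂} {D} c r same D₂⪯D D⪯D₁ j j≤r =
  cellsBelow-determines-cell c j (counts j (m≤n⇒m≤1+n j≤r)) (counts (suc j) (s≤s j≤r))
  where
  counts : ∀ n → n ≤ suc r → cellsBelow c D n ≡ cellsBelow c D₁ n
  counts n n≤1+r = cellsBelow-squeeze c n D₂⪯D D⪯D₁
    (prefixSum-cong (inColumn c D₁) (inColumn c D₂) n (λ j j<n →
      𝟙-cong (same j (≤-pred (<-≤-trans j<n n≤1+r))) _ _))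

lemma3p3 : (D₀ D₁ D₂ : Diagram) → Positive D₀ →
    D₁ ∈KD D₀ → D₂ ∈KD D₀ → D₂ ≺ D₁ →
    ((c r : ℕ) → 1 ≤ c → 1 ≤ r → SameAbove c r D₁ D₂ →
      (D : Diagram) → D ∈KD D₀ → D₂ ⪯ D → D ⪯ D₁ → SameAbove c r D D₁)
    ×
    ((c r : ℕ) → 1 ≤ c → 1 ≤ r → SameBelow c r D₁ D₂ →
      (D : Diagram) → D ∈KD D₀ → D₂ ⪯ D → D ⪯ D₁ → SameBelow c r D D₁)
lemma3p3 _ _ _ _ _ _ _ =
  (λ c r _ _ same _ _ → sameAbove-between c r same) ,
  (λ c r _ _ same _ _ → sameBelow-between c r same)
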